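{- Let $G=(V,E)$ be a finite connected undirected graph with random walk and set function $F$ as described in the context. For a constant $\bar{c}>0$, let $\mathcal{P}=\{X\subseteq V : F(X)\geq \bar{c}\}$. If $A,B\in\mathcal{P}$ satisfy $|A|=|B|$ and $|A\cap B|=|A|-1$, then $A\cap B\in\mathcal{P}$.
   Context: $G=(V,E)$ is a connected undirected graph with $N$ vertices. The random walk $(X_n)_{n\ge0}$ on $V$ has transition probabilities $p(i,j)=1/\deg(i)$ if $(i,j)\in E$ and $p(i,j)=0$ otherwise; the resulting Markov chain is assumed irreducible and aperiodic. For $A\subseteq V$, the hitting time is $T_A=\min\{n>0 : X_n\in A\}$ (with $T_\emptyset=+\infty$), and $h(i,A)=\mathbb{E}_i[T_A]$ is its expectation when the walk starts at $X_0=i$. The set function $F$ is $F(A)=\sum_{i\notin A} h(i,A)$. (It is known, and may be used, that $F$ is supermodular: $F(A\cap B)+F(A\cup B)\ge F(A)+F(B)$ for all $A,B\subseteq V$.)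
   Formalization: The constant $\bar{c}$ ranges over the positive rationals. -}

module Defs where

open import Data.Bool using (Bool; true; false; if_then_else_)
open import Data.Nat using (ℕ; zero; suc)
import Data.Nat as ℕ
open import Data.Nat.Divisibility using (_∣_)
open import Data.Integer using (+_)
open import Data.Fin using (Fin; zero; suc)
open import Data.Fin.Subset using (Subset; inside; outside)
open import Data.Vec using (lookup)
open import Data.Product using (∃)
open import Relation.Binary.PropositionalEquality using (_≡_)
open import Data.Rational using (ℚ; 0ℚ; 1ℚ; _+_; _*_; _/_; _<_; _≤_)

record Graph (N : ℕ) : Set where
  field
    adj   : Fin N → Fin N → Bool
    sym   : ∀ i j → adj i j ≡ adj j i
    loopless : ∀ i → adj i i ≡ false
open Graph public

sumℕ : ∀ {n} → (Fin n → ℕ) → ℕ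
sumℕ {zero}  f = 0
sumℕ {suc n} f = f zero ℕ.+ sumℕ (λ i → f (suc i))

sumℚ : ∀ {n} → (Fin n → ℚ) → ℚ
sumℚ {zero}  f = 0ℚ
sumℚ {suc n} f = f zero + sumℚ (λ i → f (suc i))

deg : ∀ {N} → Graph N → Fin N → ℕ
deg G i = sumℕ (λ j → if adj G i j then 1 else 0)

-- 1 / d  (the value for d = 0 is irrelevant: every vertex has positive
-- degree under the hypotheses below)
inv : ℕ → ℚ
inv zero    = 0ℚ
inv (suc d) = (+ 1) / suc d

p : ∀ {N} → Graph N → Fin N → Fin N → ℚ
p G i j = if adj G i j then inv (deg G i) else 0ℚ

data Walk {N} (G : Graph N) : Fin N → Fin N → ℕ → Set where
  here : ∀ {i} → Walk G i i 0
  step : ∀ {i k j n} → adj G i k ≡ true → Walk G k j n → Walk G i j (suc n)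

Connected : ∀ {N} → Graph N → Set
Connected G = ∀ i j → ∃ λ n → Walk G i j n

-- aperiodicity of the walk: every state has period
-- gcd { n : p^n(i,i) > 0 } = 1, i.e. the only common divisor of all
-- lengths of closed walks at i is 1
Aperiodic : ∀ {N} → Graph N → Set
Aperiodic G = ∀ i (d : ℕ) → (∀ n → Walk G i i n → d ∣ n) → d ≡ 1

-- survival probability  P_i(T_A > n) = P_i(X_1 ∉ A, …, X_n ∉ A)
surv : ∀ {N} → Graph N → Subset N → ℕ → Fin N → ℚ
surv G A zero    i = 1ℚ
surv G A (suc n) i =
  sumℚ (λ j → p G i j * (if isIn j then 0ℚ else surv G A n j))
  where
  isIn : _ → Bool
  isIn j with lookup A j
  ... | inside  = true
  ... | outside = false

-- truncated expected hitting time  E_i[min(T_A, M)] = Σ_{n<M} P_i(T_A > n)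
hTrunc : ∀ {N} → Graph N → Subset N → ℕ → Fin N → ℚ
hTrunc G A zero    i = 0ℚ
hTrunc G A (suc M) i = hTrunc G A M i + surv G A M i

-- F_M(A) = Σ_{i ∉ A} E_i[min(T_A, M)]; increases in M to F(A) ∈ [0, ∞]
FTrunc : ∀ {N} → Graph N → Subset N → ℕ → ℚ
FTrunc G A M = sumℚ (λ i → term i (lookup A i))
  where
  term : _ → _ → ℚ
  term i inside  = 0ℚ
  term i outside = hTrunc G A M i

-- F(A) ≥ c  for the extended value F(A) = sup_M F_M(A) ∈ [0, +∞]
F≥ : ∀ {N} → Graph N → Subset N → ℚ → Set
F≥ G A c = ∀ q → q < c → ∃ λ M → q ≤ FTrunc G A M

InP : ∀ {N} → Graph N → ℚ → Subset N → Set
InP G c X = F≥ G X c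

-- Enlarging the target set can only make the walk stop earlier, and it removes
-- starting points from the sum, so F is antitone under inclusion.  Hence
-- F(A ∩ B) ≥ F(A) ≥ c̄.
module Submission where

open import Defs hiding (sym)
open import Data.Bool using (Bool; true; false; if_then_else_)
open import Data.Nat using (ℕ; _+_; zero; suc)
open import Data.Fin using (Fin; zero; suc)
open import Data.Fin.Subset using (Subset; Side; inside; outside; _∩_; _⊆_; ∣_∣)
open import Data.Fin.Subset.Properties using (p∩q⊆p)
open import Data.Vec using (lookup)
open import Data.Vec.Properties using ([]=⇒lookup; lookup⇒[]=)
open import Data.Product using (Σ; _,_; proj₁; proj₂)
open import Data.Integer using (+_)
import Data.Rational as ℚ
open import Data.Rational using (ℚ; 0ℚ; 1ℚ; _*_; _/_; _<_; _≤_; nonNegative)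
open import Data.Rational.Properties
  using (≤-refl; ≤-trans; +-mono-≤; *-monoˡ-≤-nonNeg; nonNegative⁻¹; nonNeg*nonNeg⇒nonNeg; normalize-nonNeg)
open import Function using (_∘_)
open import Relation.Binary.PropositionalEquality using (_≡_; refl; sym; trans; cong; cong₂)

private
  variable
    N : ℕ

*-nonNeg : ∀ {x y} → 0ℚ ≤ x → 0ℚ ≤ y → 0ℚ ≤ x * y
*-nonNeg {x} {y} 0≤x 0≤y =
  nonNegative⁻¹ (x * y) {{nonNeg*nonNeg⇒nonNeg x {{nonNegative 0≤x}} y {{nonNegative 0≤y}}}}

sumℚ-cong : ∀ {n} {f g : Fin n → ℚ} → (∀ i → f i ≡ g i) → sumℚ f ≡ sumℚ g
sumℚ-cong {zero}  f≗g = refl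
sumℚ-cong {suc n} f≗g = cong₂ ℚ._+_ (f≗g zero) (sumℚ-cong (f≗g ∘ suc))

sumℚ-mono : ∀ {n} {f g : Fin n → ℚ} → (∀ i → f i ≤ g i) → sumℚ f ≤ sumℚ g
sumℚ-mono {zero}  f≤g = ≤-refl
sumℚ-mono {suc n} f≤g = +-mono-≤ (f≤g zero) (sumℚ-mono (f≤g ∘ suc))

sumℚ-nonNeg : ∀ {n} {f : Fin n → ℚ} → (∀ i → 0ℚ ≤ f i) → 0ℚ ≤ sumℚ f
sumℚ-nonNeg {zero}  0≤f = ≤-refl
sumℚ-nonNeg {suc n} 0≤f = +-mono-≤ (0≤f zero) (sumℚ-nonNeg (0≤f ∘ suc))

inv-nonNeg : ∀ d → 0ℚ ≤ inv d
inv-nonNeg zero    = ≤-refl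
inv-nonNeg (suc d) = nonNegative⁻¹ ((+ 1) / suc d) {{normalize-nonNeg 1 (suc d)}}

p-nonNeg : (G : Graph N) → ∀ i j → 0ℚ ≤ p G i j
p-nonNeg G i j with adj G i j
... | true  = inv-nonNeg (deg G i)
... | false = ≤-refl

ifOutside : Side → ℚ → ℚ
ifOutside inside  _ = 0ℚ
ifOutside outside x = x

ifOutside-nonNeg : ∀ s {x} → 0ℚ ≤ x → 0ℚ ≤ ifOutside s x
ifOutside-nonNeg inside  _   = ≤-refl
ifOutside-nonNeg outside 0≤x = 0≤x

ifOutside-antitone : {C A : Subset N} → C ⊆ A → ∀ j {x y} → 0ℚ ≤ y → x ≤ y →
                     ifOutside (lookup A j) x ≤ ifOutside (lookup C j) y
ifOutside-antitone {C = C} {A} C⊆A j 0≤y x≤y with lookup A j in j∈?A | lookup C j in j∈?C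
... | inside  | t       = ifOutside-nonNeg t 0≤y
... | outside | outside = x≤y
... | outside | inside
  with () ← trans (sym j∈?A) ([]=⇒lookup (C⊆A (lookup⇒[]= j C j∈?C)))

-- Defs tests membership through where-bound helpers that cannot be named here;
-- unfolding by refl makes unification name them, after which a case split on
-- the side of the vertex identifies them with ifOutside.
surv-suc : (G : Graph N) (A : Subset N) → ∀ n i →
           surv G A (suc n) i ≡ sumℚ (λ j → p G i j * ifOutside (lookup A j) (surv G A n j))
surv-suc {N} G A n i = trans (proj₂ unfolded) (sumℚ-cong λ j → cong (p G i j *_) (isIn-ifOutside j))
  where
  unfolded : Σ (Fin N → Bool) λ isIn →
             surv G A (suc n) i ≡ sumℚ (λ j → p G i j * (if isIn j then 0ℚ else surv G A n j))
  unfolded = _ , refl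

  isIn-ifOutside : ∀ j → (if proj₁ unfolded j then 0ℚ else surv G A n j) ≡ ifOutside (lookup A j) (surv G A n j)
  isIn-ifOutside j with lookup A j
  ... | inside  = refl
  ... | outside = refl

FTrunc-ifOutside : (G : Graph N) (A : Subset N) → ∀ M →
                   FTrunc G A M ≡ sumℚ (λ i → ifOutside (lookup A i) (hTrunc G A M i))
FTrunc-ifOutside {N} G A M = trans (proj₂ unfolded) (sumℚ-cong term-ifOutside)
  where
  unfolded : Σ (Fin N → ℚ) λ term → FTrunc G A M ≡ sumℚ term
  unfolded = _ , refl

  term-ifOutside : ∀ i → proj₁ unfolded i ≡ ifOutside (lookup A i) (hTrunc G A M i)
  term-ifOutside i with lookup A i
  ... | inside  = refl
  ... | outside = refl

surv-nonNeg : (G : Graph N) (A : Subset N) → ∀ n i → 0ℚ ≤ surv G A n i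
surv-nonNeg G A zero    i = nonNegative⁻¹ 1ℚ
surv-nonNeg G A (suc n) i rewrite surv-suc G A n i =
  sumℚ-nonNeg λ j → *-nonNeg (p-nonNeg G i j) (ifOutside-nonNeg (lookup A j) (surv-nonNeg G A n j))

surv-antitone : (G : Graph N) {C A : Subset N} → C ⊆ A → ∀ n i → surv G A n i ≤ surv G C n i
surv-antitone G         C⊆A zero    i = ≤-refl
surv-antitone G {C} {A} C⊆A (suc n) i rewrite surv-suc G A n i | surv-suc G C n i =
  sumℚ-mono λ j → *-monoˡ-≤-nonNeg (p G i j) {{nonNegative (p-nonNeg G i j)}}
    (ifOutside-antitone C⊆A j (surv-nonNeg G C n j) (surv-antitone G C⊆A n j))

hTrunc-nonNeg : (G : Graph N) (A : Subset N) → ∀ M i → 0ℚ ≤ hTrunc G A M i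
hTrunc-nonNeg G A zero    i = ≤-refl
hTrunc-nonNeg G A (suc M) i = +-mono-≤ (hTrunc-nonNeg G A M i) (surv-nonNeg G A M i)

hTrunc-antitone : (G : Graph N) {C A : Subset N} → C ⊆ A → ∀ M i → hTrunc G A M i ≤ hTrunc G C M i
hTrunc-antitone G C⊆A zero    i = ≤-refl
hTrunc-antitone G C⊆A (suc M) i = +-mono-≤ (hTrunc-antitone G C⊆A M i) (surv-antitone G C⊆A M i)

FTrunc-antitone : (G : Graph N) {C A : Subset N} → C ⊆ A → ∀ M → FTrunc G A M ≤ FTrunc G C M
FTrunc-antitone G {C} {A} C⊆A M rewrite FTrunc-ifOutside G A M | FTrunc-ifOutside G C M =
  sumℚ-mono λ i → ifOutside-antitone C⊆A i (hTrunc-nonNeg G C M i) (hTrunc-antitone G C⊆A M i)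

F≥-antitone : (G : Graph N) {C A : Subset N} → C ⊆ A → ∀ {c} → F≥ G A c → F≥ G C c
F≥-antitone G C⊆A F[A]≥c q q<c with F[A]≥c q q<c
... | M , q≤F[A] = M , ≤-trans q≤F[A] (FTrunc-antitone G C⊆A M)

lemma2 : ∀ {N : ℕ} (G : Graph N) → Connected G → Aperiodic G →
         (c : ℚ) → 0ℚ < c →
         (A B : Subset N) → InP G c A → InP G c B →
         ∣ A ∣ ≡ ∣ B ∣ → ∣ A ∩ B ∣ + 1 ≡ ∣ A ∣ →
         InP G c (A ∩ B)
lemma2 G _ _ c _ A B A∈𝒫 _ _ _ = F≥-antitone G (p∩q⊆p A B) A∈𝒫
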